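{- Let $G$ be a finite directed acyclic multigraph having exactly one source $s$ and exactly one sink $t$, and let $p_G$ be the unique real multilinear polynomial representing $\textsc{DAG-Connectivity}_G$. Then $\deg p_G=|G|$, the number of arcs of $G$.
   Context: A source is a vertex with no incoming arcs, a sink a vertex with no outgoing arcs. $\textsc{DAG-Connectivity}_G:\{0,1\}^{G}\to\{0,1\}$ takes one bit $x_e$ per arc $e$ of $G$ ($x_e=1$ meaning the arc is present) and outputs $1$ iff the present arcs contain a non-empty directed path from $s$ to $t$. A real multilinear polynomial represents a Boolean function if they agree on all of $\{0,1\}^{G}$.
   Formalization: The representing multilinear polynomial p_G is taken with coefficients in ℚ rather than real coefficients. -}

module Defs where

open import Data.Bool using (Bool; true; false; if_then_else_)
open import Data.Nat using (ℕ; zero; suc; _⊔_)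
open import Data.Fin using (Fin)
open import Data.Fin.Subset using (Subset; inside; outside; ∣_∣)
open import Data.Vec using ([]; _∷_; lookup)
open import Data.List using (List; [_]; map; _++_; foldr; allFin)
open import Data.Rational using (ℚ; 0ℚ; 1ℚ; _+_; _*_; _≟_)
open import Data.Product using (_×_)
open import Relation.Nullary using (¬_; does)
open import Relation.Binary.PropositionalEquality using (_≡_; _≢_)

-- A finite directed multigraph with vertices Fin n and arcs Fin m;
-- arc e goes from tl e to hd e.  An arc state x : Fin m → Bool says which arcs are present.

data Path {n m : ℕ} (tl hd : Fin m → Fin n) (present : Fin m → Bool) : Fin n → Fin n → Set where
  arc  : ∀ e {x y} → tl e ≡ x → hd e ≡ y → present e ≡ true → Path tl hd present x y
  step : ∀ e {x y} → tl e ≡ x → present e ≡ true → Path tl hd present (hd e) y → Path tl hd present x y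

Acyclic : {n m : ℕ} (tl hd : Fin m → Fin n) → Set
Acyclic tl hd = ∀ v → ¬ Path tl hd (λ _ → true) v v

IsSource : {n m : ℕ} (hd : Fin m → Fin n) → Fin n → Set
IsSource hd v = ∀ e → hd e ≢ v

IsSink : {n m : ℕ} (tl : Fin m → Fin n) → Fin n → Set
IsSink tl v = ∀ e → tl e ≢ v

-- Multilinear polynomials in variables x_e (e : Fin m): coefficient for each monomial
-- ∏_{e ∈ S} x_e, S ⊆ Fin m.
MLPoly : ℕ → Set
MLPoly m = Subset m → ℚ

allSubsets : ∀ m → List (Subset m)
allSubsets zero = [ [] ]
allSubsets (suc m) = map (outside ∷_) (allSubsets m) ++ map (inside ∷_) (allSubsets m)

bit : Bool → ℚ
bit true = 1ℚ
bit false = 0ℚ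

monomial : ∀ {m} → Subset m → (Fin m → Bool) → ℚ
monomial {m} S x = foldr _*_ 1ℚ (map (λ i → if lookup S i then bit (x i) else 1ℚ) (allFin m))

eval : ∀ {m} → MLPoly m → (Fin m → Bool) → ℚ
eval {m} p x = foldr _+_ 0ℚ (map (λ S → p S * monomial S x) (allSubsets m))

-- degree: largest |S| with nonzero coefficient (0 for the zero polynomial)
degree : ∀ {m} → MLPoly m → ℕ
degree {m} p = foldr (λ S acc → if does (p S ≟ 0ℚ) then acc else (∣ S ∣ ⊔ acc)) 0 (allSubsets m)

Represents : {n m : ℕ} (tl hd : Fin m → Fin n) (s t : Fin n) → MLPoly m → Set
Represents tl hd s t p =
  ∀ x → (Path tl hd x s t → eval p x ≡ 1ℚ) × (¬ Path tl hd x s t → eval p x ≡ 0ℚ)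

-- The coefficient of the full monomial ∏ₑ xₑ in the multilinear representation of f is the
-- alternating sum Δ f = Σₓ (-1)^(m - |x|) f x, so deg p_G = m exactly when Δ f ≠ 0. For m ≥ 1,
-- Δ vanishes on constants, hence Δ f = - Δ g for the indicator g of the arc sets with no s–t
-- path, and Δ g is evaluated by a sign-reversing involution on those sets that toggles a single
-- arc: the least arc whose tail is unreachable from s if there is one, and otherwise the least
-- "canonical" arc (least-indexed into its head v ≠ t) such that v has another present in-arc.
-- Toggling keeps the set disconnected and the choice of arc unchanged; acyclicity and the unique
-- source and sink let reachability be re-derived by walking backwards along present in-arcs.
-- The only set left fixed consists of the canonical arcs not entering t, so Δ g = ±1.

module Submission where

open import Defs
open import Data.Nat using (ℕ)
open import Data.Fin using (Fin)
open import Data.Product using (Σ; _×_)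
open import Relation.Binary.PropositionalEquality using (_≡_)

open import Data.Bool using (Bool; true; false; if_then_else_) renaming (_≟_ to _≟ᵇ_)
open import Data.Bool.Properties using (⇔→≡; not-¬)
open import Data.Empty using (⊥-elim)
open import Data.Fin using (zero; suc; _<_; _≟_)
open import Data.Fin.Properties
  using (any?; all?; _<?_; <-cmp; <-irrefl; suc-injective; 0≢1+n; injective⇒≤; ¬∀⟶∃¬)
open import Data.Fin.Subset using (Subset; inside; outside; ⊤; ∣_∣)
open import Data.Fin.Subset.Properties using (∣p∣≤n; ∣⊤∣≡n)
open import Data.List using (List; []; _∷_; map; _++_; foldr)
open import Data.List.Membership.Propositional using (_∈_)
open import Data.List.Membership.Propositional.Properties using (∈-++⁺ʳ; ∈-map⁺)
open import Data.List.Properties using (map-∘; map-cong; map-tabulate)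
open import Data.List.Relation.Unary.Any using (here; there)
open import Data.Nat using (zero; suc; _≤_; _⊔_; z≤n; s≤s)
open import Data.Nat.Properties
  using (≤-antisym; ≤-trans; ≤-reflexive; ⊔-lub; m≤m⊔n; m≤n⊔m; n≤0⇒n≡0; <⇒≤; ≤⇒≯)
open import Data.Product using (_,_; proj₁; proj₂)
import Data.Product as Product
open import Data.Rational using (ℚ; 0ℚ; 1ℚ; _+_; _*_; _-_; -_) renaming (_≟_ to _≟ℚ_)
open import Data.Rational.Properties
  using (1≢0; neg-injective; +-identityˡ; +-identityʳ; +-assoc; +-inverseʳ; +-0-commutativeMonoid; +-0-group;
         *-identityˡ; *-identityʳ; *-zeroʳ; *-distribˡ-+)
open import Data.Rational.Solver using (module +-*-Solver)
open import Data.Sum using (_⊎_; inj₁; inj₂; [_,_])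
import Data.Sum as Sum
open import Data.Vec using ([]; _∷_; lookup)
open import Function using (_∘_; _∘₂_)
open import Function.Bundles using (_⇔_; mk⇔)
open import Function.Definitions using (Injective)
open import Relation.Binary using (tri<; tri≈; tri>)
open import Relation.Binary.PropositionalEquality
  using (_≢_; _≗_; refl; sym; trans; cong; cong₂; subst; module ≡-Reasoning)
open import Relation.Nullary using (¬_; Dec; does; yes; no; ¬?)
open import Relation.Nullary.Decidable using (dec-true; dec-false; does-⇔; map′; _×-dec_; _⊎-dec_; _→-dec_)

open import Algebra.Properties.CommutativeMonoid.Sum +-0-commutativeMonoid using (sum; sum-cong-≗; sum-replicate-zero)
open import Algebra.Properties.Group +-0-group using (⁻¹-involutive)
open +-*-Solver using (solve; _:+_; _:*_; _:-_; _:=_; con)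

State : ℕ → Set
State m = Fin m → Bool

infixr 5 _◂_
_◂_ : ∀ {m} → Bool → State m → State (suc m)
(b ◂ y) zero    = b
(b ◂ y) (suc i) = y i

◂-η : ∀ {m} (x : State (suc m)) → (x zero ◂ x ∘ suc) ≗ x
◂-η x zero    = refl
◂-η x (suc i) = refl

◂-cong : ∀ {m} b {y y' : State m} → y ≗ y' → (b ◂ y) ≗ (b ◂ y')
◂-cong b y≗y' zero    = refl
◂-cong b y≗y' (suc i) = y≗y' i

Extensional : ∀ {m} → (State m → ℚ) → Set
Extensional g = ∀ {x x'} → x ≗ x' → g x ≡ g x'

∑ᴸ : {A : Set} → List A → (A → ℚ) → ℚ
∑ᴸ L f = foldr _+_ 0ℚ (map f L)

∑ᴸ-++ : {A : Set} (L₁ L₂ : List A) (f : A → ℚ) → ∑ᴸ (L₁ ++ L₂) f ≡ ∑ᴸ L₁ f + ∑ᴸ L₂ f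
∑ᴸ-++ [] L₂ f = sym (+-identityˡ (∑ᴸ L₂ f))
∑ᴸ-++ (a ∷ L₁) L₂ f = trans (cong (f a +_) (∑ᴸ-++ L₁ L₂ f)) (sym (+-assoc (f a) _ _))

∑ᴸ-map : {A B : Set} (g : A → B) (L : List A) (f : B → ℚ) → ∑ᴸ (map g L) f ≡ ∑ᴸ L (f ∘ g)
∑ᴸ-map g L f = cong (foldr _+_ 0ℚ) (sym (map-∘ L))

∑ᴸ-cong : {A : Set} (L : List A) {f g : A → ℚ} → f ≗ g → ∑ᴸ L f ≡ ∑ᴸ L g
∑ᴸ-cong L f≗g = cong (foldr _+_ 0ℚ) (map-cong f≗g L)

∑ᴸ-*ˡ : {A : Set} (c : ℚ) (L : List A) (f : A → ℚ) → c * ∑ᴸ L f ≡ ∑ᴸ L (λ a → c * f a)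
∑ᴸ-*ˡ c [] f = *-zeroʳ c
∑ᴸ-*ˡ c (a ∷ L) f = trans (*-distribˡ-+ c (f a) _) (cong (c * f a +_) (∑ᴸ-*ˡ c L f))

monomial-∷ : ∀ {m} b (S : Subset m) (x : State (suc m)) →
  monomial (b ∷ S) x ≡ (if b then bit (x zero) else 1ℚ) * monomial S (x ∘ suc)
monomial-∷ {m} b S x = cong (factor zero *_) (cong (foldr _*_ 1ℚ)
  (trans (map-tabulate suc factor) (sym (map-tabulate (λ i → i) (factor ∘ suc)))))
  where
  factor : Fin (suc m) → ℚ
  factor i = if lookup (b ∷ S) i then bit (x i) else 1ℚ

tail₀ tail₁ : ∀ {m} → MLPoly (suc m) → MLPoly m
tail₀ p S = p (outside ∷ S)
tail₁ p S = p (inside ∷ S)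

eval-split : ∀ {m} (p : MLPoly (suc m)) (x : State (suc m)) →
  eval p x ≡ eval (tail₀ p) (x ∘ suc) + bit (x zero) * eval (tail₁ p) (x ∘ suc)
eval-split {m} p x = begin
  ∑ᴸ (map (outside ∷_) A ++ map (inside ∷_) A) term
    ≡⟨ ∑ᴸ-++ (map (outside ∷_) A) _ term ⟩
  ∑ᴸ (map (outside ∷_) A) term + ∑ᴸ (map (inside ∷_) A) term
    ≡⟨ cong₂ _+_ (∑ᴸ-map (outside ∷_) A term) (∑ᴸ-map (inside ∷_) A term) ⟩
  ∑ᴸ A (term ∘ (outside ∷_)) + ∑ᴸ A (term ∘ (inside ∷_))
    ≡⟨ cong₂ _+_ (∑ᴸ-cong A without) (∑ᴸ-cong A with′) ⟩
  eval (tail₀ p) y + ∑ᴸ A (λ S → bit (x zero) * (tail₁ p S * monomial S y))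
    ≡⟨ cong (eval (tail₀ p) y +_) (sym (∑ᴸ-*ˡ (bit (x zero)) A _)) ⟩
  eval (tail₀ p) y + bit (x zero) * eval (tail₁ p) y ∎
  where
  open ≡-Reasoning
  A = allSubsets m
  y = x ∘ suc
  term : Subset (suc m) → ℚ
  term S = p S * monomial S x
  without : ∀ S → term (outside ∷ S) ≡ tail₀ p S * monomial S y
  without S = cong (tail₀ p S *_) (trans (monomial-∷ outside S x) (*-identityˡ _))
  with′ : ∀ S → term (inside ∷ S) ≡ bit (x zero) * (tail₁ p S * monomial S y)
  with′ S = trans (cong (tail₁ p S *_) (monomial-∷ inside S x))
    (solve 3 (λ a b c → a :* (b :* c) := b :* (a :* c)) refl (tail₁ p S) (bit (x zero)) (monomial S y))

eval-nullary : (p : MLPoly 0) (x : State 0) → eval p x ≡ p []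
eval-nullary p x = trans (+-identityʳ _) (*-identityʳ _)

Δ : ∀ m → (State m → ℚ) → ℚ
Δ zero    g = g (λ ())
Δ (suc m) g = Δ m (λ y → g (true ◂ y) - g (false ◂ y))

⊤-coefficient : ∀ m (p : MLPoly m) {g : State m → ℚ} → eval p ≗ g → p ⊤ ≡ Δ m g
⊤-coefficient zero    p p≗g = trans (sym (eval-nullary p (λ ()))) (p≗g (λ ()))
⊤-coefficient (suc m) p {g} p≗g = ⊤-coefficient m (tail₁ p) difference
  where
  difference : ∀ y → eval (tail₁ p) y ≡ g (true ◂ y) - g (false ◂ y)
  difference y = solve-for {c = eval (tail₀ p) y} (trans (sym (p≗g _)) (eval-split p (true ◂ y)))
                           (trans (sym (p≗g _)) (eval-split p (false ◂ y)))
    where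
    solve-for : ∀ {a b c d} → a ≡ c + 1ℚ * d → b ≡ c + 0ℚ * d → d ≡ a - b
    solve-for {c = c} {d} refl refl =
      solve 2 (λ c d → d := (c :+ con 1ℚ :* d) :- (c :+ con 0ℚ :* d)) refl c d

interpolate : ∀ m → (State m → ℚ) → MLPoly m
interpolate zero    g []           = g (λ ())
interpolate (suc m) g (outside ∷ S) = interpolate m (λ y → g (false ◂ y)) S
interpolate (suc m) g (inside ∷ S)  = interpolate m (λ y → g (true ◂ y) - g (false ◂ y)) S

eval-interpolate : ∀ m (g : State m → ℚ) → Extensional g → eval (interpolate m g) ≗ g
eval-interpolate zero    g ext x = trans (eval-nullary (interpolate zero g) x) (ext (λ ()))
eval-interpolate (suc m) g ext x = begin
  eval (interpolate (suc m) g) x                ≡⟨ eval-split (interpolate (suc m) g) x ⟩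
  eval (interpolate m g₀) y + bit (x zero) * eval (interpolate m g₁) y
    ≡⟨ cong₂ (λ a b → a + bit (x zero) * b) (eval-interpolate m g₀ ext₀ y) (eval-interpolate m g₁ ext₁ y) ⟩
  g₀ y + bit (x zero) * g₁ y                     ≡⟨ shannon (x zero) ⟩
  g (x zero ◂ y)                                  ≡⟨ ext (◂-η x) ⟩
  g x                                             ∎
  where
  open ≡-Reasoning
  y = x ∘ suc
  g₀ g₁ : State m → ℚ
  g₀ z = g (false ◂ z)
  g₁ z = g (true ◂ z) - g (false ◂ z)
  ext₀ : Extensional g₀
  ext₀ z≗z' = ext (◂-cong false z≗z')
  ext₁ : Extensional g₁
  ext₁ z≗z' = cong₂ _-_ (ext (◂-cong true z≗z')) (ext (◂-cong false z≗z'))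
  shannon : ∀ b → g₀ y + bit b * g₁ y ≡ g (b ◂ y)
  shannon true  = solve 2 (λ a c → a :+ con 1ℚ :* (c :- a) := c) refl (g₀ y) (g (true ◂ y))
  shannon false = solve 2 (λ a c → a :+ con 0ℚ :* (c :- a) := a) refl (g₀ y) (g (true ◂ y))

degreeOver : ∀ {m} → MLPoly m → List (Subset m) → ℕ
degreeOver p = foldr (λ S acc → if does (p S ≟ℚ 0ℚ) then acc else (∣ S ∣ ⊔ acc)) 0

degreeOver≤ : ∀ {m} (p : MLPoly m) (L : List (Subset m)) → degreeOver p L ≤ m
degreeOver≤ p []      = z≤n
degreeOver≤ p (S ∷ L) with does (p S ≟ℚ 0ℚ)
... | true  = degreeOver≤ p L
... | false = ⊔-lub (∣p∣≤n S) (degreeOver≤ p L)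

degreeOver≥ : ∀ {m} (p : MLPoly m) {L : List (Subset m)} → ⊤ ∈ L → p ⊤ ≢ 0ℚ → m ≤ degreeOver p L
degreeOver≥ {m} p (here refl) p⊤≢0 with p ⊤ ≟ℚ 0ℚ
... | yes p⊤≡0 = ⊥-elim (p⊤≢0 p⊤≡0)
... | no _     = ≤-trans (≤-reflexive (sym (∣⊤∣≡n m))) (m≤m⊔n _ _)
degreeOver≥ p {S ∷ _} (there ⊤∈L) p⊤≢0 with does (p S ≟ℚ 0ℚ)
... | true  = degreeOver≥ p ⊤∈L p⊤≢0
... | false = ≤-trans (degreeOver≥ p ⊤∈L p⊤≢0) (m≤n⊔m _ _)

⊤∈allSubsets : ∀ m → ⊤ ∈ allSubsets m
⊤∈allSubsets zero    = here refl
⊤∈allSubsets (suc m) = ∈-++⁺ʳ (map (outside ∷_) (allSubsets m)) (∈-map⁺ (inside ∷_) (⊤∈allSubsets m))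

degree≤ : ∀ {m} (p : MLPoly m) → degree p ≤ m
degree≤ {m} p = degreeOver≤ p (allSubsets m)

degree-full : ∀ {m} (p : MLPoly m) → (Fin m → p ⊤ ≢ 0ℚ) → degree p ≡ m
degree-full {zero}  p _     = n≤0⇒n≡0 (degree≤ p)
degree-full {suc m} p p⊤≢0 = ≤-antisym (degree≤ p) (degreeOver≥ p (⊤∈allSubsets (suc m)) (p⊤≢0 zero))

Δ-cong : ∀ m {g h : State m → ℚ} → g ≗ h → Δ m g ≡ Δ m h
Δ-cong zero    g≗h = g≗h _
Δ-cong (suc m) g≗h = Δ-cong m (λ y → cong₂ _-_ (g≗h _) (g≗h _))

Δ-+ : ∀ m (g h : State m → ℚ) → Δ m (λ x → g x + h x) ≡ Δ m g + Δ m h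
Δ-+ zero    g h = refl
Δ-+ (suc m) g h = trans (Δ-cong m (λ y → interchange (g (true ◂ y)) (h (true ◂ y)) (g (false ◂ y)) (h (false ◂ y))))
                        (Δ-+ m _ _)
  where
  interchange : ∀ a b c d → (a + b) - (c + d) ≡ (a - c) + (b - d)
  interchange = solve 4 (λ a b c d → (a :+ b) :- (c :+ d) := (a :- c) :+ (b :- d)) refl

Δ-0 : ∀ m → Δ m (λ _ → 0ℚ) ≡ 0ℚ
Δ-0 zero    = refl
Δ-0 (suc m) = Δ-0 m

Δ-sum : ∀ m {k} (H : Fin k → State m → ℚ) → Δ m (λ x → sum (λ e → H e x)) ≡ sum (λ e → Δ m (H e))
Δ-sum m {zero}  H = Δ-0 m
Δ-sum m {suc k} H = trans (Δ-+ m (H zero) _) (cong (Δ m (H zero) +_) (Δ-sum m (H ∘ suc)))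

AgreeOff : ∀ {m} → Fin m → State m → State m → Set
AgreeOff e x x' = ∀ i → i ≢ e → x i ≡ x' i

agree-sym : ∀ {m} {e : Fin m} {x x'} → AgreeOff e x x' → AgreeOff e x' x
agree-sym agree i i≢e = sym (agree i i≢e)

IndependentOf : ∀ {m} → Fin m → (State m → ℚ) → Set
IndependentOf e h = ∀ {x x'} → AgreeOff e x x' → h x ≡ h x'

Δ-independent : ∀ m (e : Fin m) (h : State m → ℚ) → IndependentOf e h → Δ m h ≡ 0ℚ
Δ-independent (suc m) zero h indep = trans (Δ-cong m cancel) (Δ-0 m)
  where
  cancel : ∀ y → h (true ◂ y) - h (false ◂ y) ≡ 0ℚ
  cancel y = trans (cong (_- h (false ◂ y)) (indep λ { zero 0≢0 → ⊥-elim (0≢0 refl) ; (suc i) _ → refl }))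
                   (+-inverseʳ (h (false ◂ y)))
Δ-independent (suc m) (suc e) h indep = Δ-independent m e _ λ agree →
  cong₂ _-_ (indep (extend true agree)) (indep (extend false agree))
  where
  extend : ∀ b {y y'} → AgreeOff e y y' → AgreeOff (suc e) (b ◂ y) (b ◂ y')
  extend b agree zero    _    = refl
  extend b agree (suc i) i≢e = agree i (i≢e ∘ cong suc)

Δ-point : ∀ m (x₀ : State m) (c : ℚ) (g : State m → ℚ) →
  (∀ x → x ≗ x₀ → g x ≡ c) → (∀ x → ¬ x ≗ x₀ → g x ≡ 0ℚ) → Δ m g ≡ c ⊎ Δ m g ≡ - c
Δ-point zero    x₀ c g at off = inj₁ (at _ (λ ()))
Δ-point (suc m) x₀ c g at off = by-head (x₀ zero) refl
  where
  y₀ = x₀ ∘ suc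
  at-point : ∀ {b} y → x₀ zero ≡ b → y ≗ y₀ → g (b ◂ y) ≡ c
  at-point y x₀-head y≗y₀ = at _ λ { zero → sym x₀-head ; (suc i) → y≗y₀ i }
  off-head : ∀ {b} y → x₀ zero ≢ b → g (b ◂ y) ≡ 0ℚ
  off-head y x₀≢b = off _ λ b◂y≗x₀ → x₀≢b (sym (b◂y≗x₀ zero))
  off-tail : ∀ y → ¬ y ≗ y₀ → g (true ◂ y) - g (false ◂ y) ≡ 0ℚ
  off-tail y y≉y₀ = cong₂ _-_ (off _ λ ≗x₀ → y≉y₀ (≗x₀ ∘ suc)) (off _ λ ≗x₀ → y≉y₀ (≗x₀ ∘ suc))
  by-head : ∀ b → x₀ zero ≡ b → Δ (suc m) g ≡ c ⊎ Δ (suc m) g ≡ - c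
  by-head true  x₀-head = Δ-point m y₀ c _
    (λ y y≗y₀ → trans (cong₂ _-_ (at-point y x₀-head y≗y₀) (off-head y (not-¬ x₀-head))) (+-identityʳ c))
    off-tail
  by-head false x₀-head = Sum.swap (Sum.map₂ (λ Δ≡⁻⁻c → trans Δ≡⁻⁻c (⁻¹-involutive c))
    (Δ-point m y₀ (- c) _
      (λ y y≗y₀ → trans (cong₂ _-_ (off-head y (not-¬ x₀-head)) (at-point y x₀-head y≗y₀)) (+-identityˡ (- c)))
      off-tail))

does-true : {A : Set} (A? : Dec A) → does A? ≡ true → A
does-true (yes a) _ = a

indicator : {A : Set} → Dec A → ℚ
indicator A? = bit (does A?)

indicator-⇔ : {A B : Set} → A ⇔ B → (A? : Dec A) (B? : Dec B) → indicator A? ≡ indicator B?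
indicator-⇔ A⇔B A? B? = cong bit (does-⇔ A⇔B A? B?)

indicator-yes : {A : Set} (A? : Dec A) → A → indicator A? ≡ 1ℚ
indicator-yes A? a = cong bit (dec-true A? a)

indicator-no : {A : Set} (A? : Dec A) → ¬ A → indicator A? ≡ 0ℚ
indicator-no A? ¬a = cong bit (dec-false A? ¬a)

indicator-complement : {A : Set} (A? : Dec A) → indicator A? + indicator (¬? A?) ≡ 1ℚ
indicator-complement (yes _) = +-identityʳ 1ℚ
indicator-complement (no _)  = +-identityˡ 1ℚ

indicator-split : {A B : Set} (A? : Dec A) (B? : Dec B) → (B → A) →
  indicator A? ≡ indicator (A? ×-dec ¬? B?) + indicator B?
indicator-split (yes a) (yes b) B⇒A = sym (+-identityˡ 1ℚ)
indicator-split (yes a) (no ¬b) B⇒A = sym (+-identityʳ 1ℚ)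
indicator-split (no ¬a) (yes b) B⇒A = ⊥-elim (¬a (B⇒A b))
indicator-split (no ¬a) (no ¬b) B⇒A = refl

sum-indicator-exclusive : ∀ {k} {P : Fin k → Set} (P? : ∀ i → Dec (P i)) →
  (∀ {i j} → P i → P j → i ≡ j) → sum (λ i → indicator (P? i)) ≡ indicator (any? P?)
sum-indicator-exclusive {zero}  P? exclusive = refl
sum-indicator-exclusive {suc k} P? exclusive
  with P? zero | sum-indicator-exclusive (P? ∘ suc) (suc-injective ∘₂ exclusive)
... | yes p₀ | rest =
  trans (cong (1ℚ +_) (trans rest (indicator-no (any? (P? ∘ suc)) λ (_ , pⱼ) → 0≢1+n (exclusive p₀ pⱼ))))
        (+-identityʳ 1ℚ)
... | no _   | rest = trans (+-identityˡ _) rest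

module Walks {n m : ℕ} (tl hd : Fin m → Fin n) where

  infix 4 _⊢_⇝_ _⊢_⇝*_ _⊑_

  _⊢_⇝_ : State m → Fin n → Fin n → Set
  x ⊢ a ⇝ b = Path tl hd x a b

  _⊢_⇝*_ : State m → Fin n → Fin n → Set
  x ⊢ a ⇝* b = a ≡ b ⊎ x ⊢ a ⇝ b

  _⊑_ : State m → State m → Set
  x ⊑ x' = ∀ i → x i ≡ true → x' i ≡ true

  length : ∀ {x a b} → x ⊢ a ⇝ b → ℕ
  length (arc _ _ _ _)  = 1
  length (step _ _ _ p) = suc (length p)

  ⇝-mono : ∀ {x x' a b} → x ⊑ x' → x ⊢ a ⇝ b → x' ⊢ a ⇝ b
  ⇝-mono x⊑x' (arc e tlₑ hdₑ xₑ)  = arc e tlₑ hdₑ (x⊑x' e xₑ)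
  ⇝-mono x⊑x' (step e tlₑ xₑ p) = step e tlₑ (x⊑x' e xₑ) (⇝-mono x⊑x' p)

  last-arc : ∀ {x a b} → x ⊢ a ⇝ b → Σ (Fin m) λ e → hd e ≡ b × x e ≡ true
  last-arc (arc e _ hdₑ xₑ) = e , hdₑ , xₑ
  last-arc (step _ _ _ p)   = last-arc p

  in-arc : ∀ {x a b} → x ⊢ a ⇝* b → b ≢ a → Σ (Fin m) λ e → hd e ≡ b × x e ≡ true
  in-arc (inj₁ a≡b) b≢a = ⊥-elim (b≢a (sym a≡b))
  in-arc (inj₂ p)   _   = last-arc p

  ⇝-snoc : ∀ {x a c e} → x ⊢ a ⇝ c → tl e ≡ c → x e ≡ true → x ⊢ a ⇝ hd e
  ⇝-snoc {e = e} (arc e₁ tl₁ refl x₁) tlₑ xₑ = step e₁ tl₁ x₁ (arc e tlₑ refl xₑ)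
  ⇝-snoc (step e₁ tl₁ x₁ p) tlₑ xₑ = step e₁ tl₁ x₁ (⇝-snoc p tlₑ xₑ)

  length-snoc : ∀ {x a c e} (p : x ⊢ a ⇝ c) (tlₑ : tl e ≡ c) (xₑ : x e ≡ true) →
    length (⇝-snoc p tlₑ xₑ) ≡ suc (length p)
  length-snoc (arc _ _ refl _) _ _ = refl
  length-snoc (step _ _ _ p) tlₑ xₑ = cong suc (length-snoc p tlₑ xₑ)

  ⇝*-snoc : ∀ {x a c e} → x ⊢ a ⇝* c → tl e ≡ c → x e ≡ true → x ⊢ a ⇝ hd e
  ⇝*-snoc {e = e} (inj₁ refl) tlₑ xₑ = arc e tlₑ refl xₑ
  ⇝*-snoc (inj₂ p) tlₑ xₑ = ⇝-snoc p tlₑ xₑ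

  ⇝*-cons : ∀ {x a c e} → tl e ≡ a → x e ≡ true → x ⊢ hd e ⇝* c → x ⊢ a ⇝ c
  ⇝*-cons {e = e} tlₑ xₑ (inj₁ refl) = arc e tlₑ refl xₑ
  ⇝*-cons {e = e} tlₑ xₑ (inj₂ p)    = step e tlₑ xₑ p

  ⇝-trans : ∀ {x a b c} → x ⊢ a ⇝ b → x ⊢ b ⇝ c → x ⊢ a ⇝ c
  ⇝-trans (arc e tlₑ refl xₑ) q = step e tlₑ xₑ q
  ⇝-trans (step e tlₑ xₑ p) q = step e tlₑ xₑ (⇝-trans p q)

  ⇝*-trans : ∀ {x a b c} → x ⊢ a ⇝* b → x ⊢ b ⇝ c → x ⊢ a ⇝ c
  ⇝*-trans (inj₁ refl) q = q
  ⇝*-trans (inj₂ p)    q = ⇝-trans p q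

  split-at-first-use : ∀ {e x x' a b} → AgreeOff e x x' → x ⊢ a ⇝ b → x' ⊢ a ⇝ b ⊎ x' ⊢ a ⇝* tl e
  split-at-first-use {e} agree (arc e₁ tl₁ hd₁ x₁) with e₁ ≟ e
  ... | yes refl = inj₂ (inj₁ (sym tl₁))
  ... | no e₁≢e  = inj₁ (arc e₁ tl₁ hd₁ (trans (sym (agree e₁ e₁≢e)) x₁))
  split-at-first-use {e} agree (step e₁ tl₁ x₁ p) with e₁ ≟ e
  ... | yes refl = inj₂ (inj₁ (sym tl₁))
  ... | no e₁≢e with split-at-first-use agree p
  ...   | inj₁ p' = inj₁ (step e₁ tl₁ (trans (sym (agree e₁ e₁≢e)) x₁) p')
  ...   | inj₂ r  = inj₂ (inj₂ (⇝*-cons tl₁ (trans (sym (agree e₁ e₁≢e)) x₁) r))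

  split-at-last-use : ∀ {e x x' a b} → AgreeOff e x x' → x ⊢ a ⇝ b → x' ⊢ a ⇝ b ⊎ x' ⊢ hd e ⇝* b
  split-at-last-use {e} agree (arc e₁ tl₁ hd₁ x₁) with e₁ ≟ e
  ... | yes refl = inj₂ (inj₁ hd₁)
  ... | no e₁≢e  = inj₁ (arc e₁ tl₁ hd₁ (trans (sym (agree e₁ e₁≢e)) x₁))
  split-at-last-use {e} agree (step e₁ tl₁ x₁ p) with split-at-last-use agree p
  ... | inj₂ r  = inj₂ r
  ... | inj₁ p' with e₁ ≟ e
  ...   | yes refl = inj₂ (inj₂ p')
  ...   | no e₁≢e  = inj₁ (step e₁ tl₁ (trans (sym (agree e₁ e₁≢e)) x₁) p')

  module _ (acyclic : Acyclic tl hd) where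

    no-cycle : ∀ {x v} → ¬ x ⊢ v ⇝ v
    no-cycle {v = v} cycle = acyclic v (⇝-mono (λ _ _ → refl) cycle)

    vertex : ∀ {x a b} (p : x ⊢ a ⇝ b) → Fin (suc (length p)) → Fin n
    vertex {a = a} (arc _ _ _ _)  zero          = a
    vertex {b = b} (arc _ _ _ _)  (suc zero)    = b
    vertex {a = a} (step _ _ _ p) zero          = a
    vertex         (step _ _ _ p) (suc j)       = vertex p j

    vertex-reachable : ∀ {x a b} (p : x ⊢ a ⇝ b) j → x ⊢ a ⇝* vertex p j
    vertex-reachable (arc e tlₑ hdₑ xₑ) zero       = inj₁ refl
    vertex-reachable (arc e tlₑ hdₑ xₑ) (suc zero) = inj₂ (arc e tlₑ hdₑ xₑ)
    vertex-reachable (step e tlₑ xₑ p)  zero       = inj₁ refl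
    vertex-reachable (step e tlₑ xₑ p)  (suc j)    = inj₂ (⇝*-cons tlₑ xₑ (vertex-reachable p j))

    vertex-injective : ∀ {x a b} (p : x ⊢ a ⇝ b) → Injective _≡_ _≡_ (vertex p)
    vertex-injective {x} (arc e tlₑ hdₑ xₑ) {zero} {zero} _ = refl
    vertex-injective {x} (arc e tlₑ hdₑ xₑ) {zero} {suc zero} a≡b =
      ⊥-elim (no-cycle {x} (arc e tlₑ (trans hdₑ (sym a≡b)) xₑ))
    vertex-injective {x} (arc e tlₑ hdₑ xₑ) {suc zero} {zero} b≡a =
      ⊥-elim (no-cycle {x} (arc e tlₑ (trans hdₑ b≡a) xₑ))
    vertex-injective {x} (arc e tlₑ hdₑ xₑ) {suc zero} {suc zero} _ = refl
    vertex-injective {x} (step e tlₑ xₑ p) {zero} {zero} _ = refl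
    vertex-injective {x} (step e tlₑ xₑ p) {zero} {suc j} a≡vⱼ =
      ⊥-elim (no-cycle (⇝*-cons tlₑ xₑ (subst (x ⊢ hd e ⇝*_) (sym a≡vⱼ) (vertex-reachable p j))))
    vertex-injective {x} (step e tlₑ xₑ p) {suc i} {zero} vᵢ≡a =
      ⊥-elim (no-cycle (⇝*-cons tlₑ xₑ (subst (x ⊢ hd e ⇝*_) vᵢ≡a (vertex-reachable p i))))
    vertex-injective {x} (step e tlₑ xₑ p) {suc i} {suc j} vᵢ≡vⱼ = cong suc (vertex-injective p vᵢ≡vⱼ)

    length<n : ∀ {x a b} (p : x ⊢ a ⇝ b) → suc (length p) ≤ n
    length<n p = injective⇒≤ (vertex-injective p)

    bounded-path? : ∀ x k a b → Dec (Σ (x ⊢ a ⇝ b) λ p → length p ≤ k)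
    bounded-path? x zero a b = no λ { (arc _ _ _ _ , ()) ; (step _ _ _ _ , ()) }
    bounded-path? x (suc k) a b
      with any? (λ e → tl e ≟ a ×-dec x e ≟ᵇ true ×-dec (hd e ≟ b ⊎-dec bounded-path? x k (hd e) b))
    ... | yes (e , tlₑ , xₑ , inj₁ hdₑ)       = yes (arc e tlₑ hdₑ xₑ , s≤s z≤n)
    ... | yes (e , tlₑ , xₑ , inj₂ (p , p≤k)) = yes (step e tlₑ xₑ p , s≤s p≤k)
    ... | no ∄ = no λ { (arc e tlₑ hdₑ xₑ , _)       → ∄ (e , tlₑ , xₑ , inj₁ hdₑ)
                      ; (step e tlₑ xₑ p , s≤s p≤k) → ∄ (e , tlₑ , xₑ , inj₂ (p , p≤k)) }

    path? : ∀ x a b → Dec (x ⊢ a ⇝ b)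
    path? x a b = map′ proj₁ (λ p → p , <⇒≤ (length<n p)) (bounded-path? x n a b)

    reach? : ∀ x a b → Dec (x ⊢ a ⇝* b)
    reach? x a b = a ≟ b ⊎-dec path? x a b

Least : ∀ {k} → (Fin k → Set) → Fin k → Set
Least Q e = Q e × (∀ e' → e' < e → ¬ Q e')

least? : ∀ {k} {Q : Fin k → Set} → (∀ e → Dec (Q e)) → ∀ e → Dec (Least Q e)
least? Q? e = Q? e ×-dec all? (λ e' → e' <? e →-dec ¬? (Q? e'))

least-unique : ∀ {k} {Q : Fin k → Set} {a b} → Least Q a → Least Q b → a ≡ b
least-unique {a = a} {b} (qa , a-min) (qb , b-min) with <-cmp a b
... | tri< a<b _ _ = ⊥-elim (b-min a a<b qa)
... | tri≈ _ a≡b _ = a≡b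
... | tri> _ _ b<a = ⊥-elim (a-min b b<a qb)

least-exists : ∀ {k} {Q : Fin k → Set} → (∀ e → Dec (Q e)) → ∀ e → Q e → Σ (Fin k) (Least Q)
least-exists Q? zero    qₑ = zero , qₑ , λ _ ()
least-exists Q? (suc e) qₑ with Q? zero
... | yes q₀ = zero , q₀ , λ _ ()
... | no ¬q₀ with least-exists (Q? ∘ suc) e qₑ
...   | a , qₐ , a-min = suc a , qₐ , λ { zero _ → ¬q₀ ; (suc e') (s≤s e'<a) → a-min e' e'<a }

least-of-¬∀ : ∀ {k} {Q : Fin k → Set} → (∀ e → Dec (Q e)) → ¬ (∀ e → Q e) → Σ (Fin k) (Least (¬_ ∘ Q))
least-of-¬∀ {k} {Q} Q? ¬∀Q with ¬∀⟶∃¬ k Q Q? ¬∀Q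
... | e , ¬qₑ = least-exists (¬? ∘ Q?) e ¬qₑ

module Involution {n m : ℕ} (tl hd : Fin m → Fin n) (s t : Fin n)
  (acyclic : Acyclic tl hd)
  (s-source : IsSource hd s) (s-unique : ∀ v → IsSource hd v → v ≡ s)
  (t-sink : IsSink tl t) (t-unique : ∀ v → IsSink tl v → v ≡ t) where

  open Walks tl hd

  out-arc : ∀ v → v ≢ t → Σ (Fin m) λ e → tl e ≡ v
  out-arc v v≢t with any? (λ e → tl e ≟ v)
  ... | yes found = found
  ... | no ∄ = ⊥-elim (v≢t (t-unique v λ e tlₑ≡v → ∄ (e , tlₑ≡v)))

  into-arc : ∀ v → v ≢ s → Σ (Fin m) λ e → hd e ≡ v
  into-arc v v≢s with any? (λ e → hd e ≟ v)
  ... | yes found = found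
  ... | no ∄ = ⊥-elim (v≢s (s-unique v λ e hdₑ≡v → ∄ (e , hdₑ≡v)))

  InArcsPresent : State m → Set
  InArcsPresent x = ∀ u → u ≢ s → u ≢ t → Σ (Fin m) λ b → hd b ≡ u × x b ≡ true

  LongWalkInto : State m → ℕ → Fin n → Set
  LongWalkInto x k u = Σ (Fin n) λ w → Σ (x ⊢ w ⇝ u) λ p → k ≤ length p

  walk-back : ∀ {x} → InArcsPresent x → ∀ k u → u ≢ t → x ⊢ s ⇝* u ⊎ LongWalkInto x k u
  walk-back {x} present k u u≢t with u ≟ s
  ... | yes u≡s = inj₁ (inj₁ (sym u≡s))
  ... | no u≢s with present u u≢s u≢t
  ...   | b , refl , xb = extend k
    where
    extend : ∀ k → x ⊢ s ⇝* hd b ⊎ LongWalkInto x k (hd b)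
    extend zero = inj₂ (tl b , arc b refl refl xb , z≤n)
    extend (suc k) with walk-back present k (tl b) (t-sink b)
    ... | inj₁ r           = inj₁ (inj₂ (⇝*-snoc r refl xb))
    ... | inj₂ (w , p , k≤) =
      inj₂ (w , ⇝-snoc p refl xb , ≤-trans (s≤s k≤) (≤-reflexive (sym (length-snoc p refl xb))))

  -- Walking backwards along present arcs must stop at s, since a walk has fewer than n arcs.
  reachable-from-in-arcs : ∀ {x} → InArcsPresent x → ∀ u → u ≢ t → x ⊢ s ⇝* u
  reachable-from-in-arcs present u u≢t with walk-back present n u u≢t
  ... | inj₁ r           = r
  ... | inj₂ (_ , p , n≤) = ⊥-elim (≤⇒≯ n≤ (length<n acyclic p))

  TailsReachable : State m → Set
  TailsReachable x = ∀ e → x ⊢ s ⇝* tl e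

  tails-reachable⇒reachable : ∀ {x} → TailsReachable x → ∀ v → v ≢ t → x ⊢ s ⇝* v
  tails-reachable⇒reachable reach v v≢t with out-arc v v≢t
  ... | e , refl = reach e

  Canonical : Fin m → Set
  Canonical e = ∀ e' → e' < e → hd e' ≢ hd e

  canonical? : ∀ e → Dec (Canonical e)
  canonical? e = all? (λ e' → e' <? e →-dec ¬? (hd e' ≟ hd e))

  canonical-unique : ∀ {a b} → Canonical a → Canonical b → hd a ≡ hd b → a ≡ b
  canonical-unique {a} canon-a canon-b hdₐ≡hdb =
    least-unique {Q = λ c → hd c ≡ hd a} (refl , canon-a)
                 (sym hdₐ≡hdb , λ e' e'<b hd≡ → canon-b e' e'<b (trans hd≡ hdₐ≡hdb))

  canonical-arc : ∀ i → Σ (Fin m) λ a → hd a ≡ hd i × Canonical a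
  canonical-arc i with least-exists (λ e → hd e ≟ hd i) i refl
  ... | a , hdₐ≡hdᵢ , a-min = a , hdₐ≡hdᵢ , λ e' e'<a hd≡ → a-min e' e'<a (trans hd≡ hdₐ≡hdᵢ)

  Kept : Fin m → Set
  Kept e = Canonical e × hd e ≢ t

  kept? : ∀ e → Dec (Kept e)
  kept? e = canonical? e ×-dec ¬? (hd e ≟ t)

  UnreachableTail : State m → Fin m → Set
  UnreachableTail x e = ¬ x ⊢ s ⇝* tl e

  Rival : State m → Fin m → Set
  Rival x e = Σ (Fin m) λ b → b ≢ e × hd b ≡ hd e × x b ≡ true

  Defective : State m → Fin m → Set
  Defective x e = Kept e × Rival x e

  Pivot : State m → Fin m → Set
  Pivot x e = Least (UnreachableTail x) e ⊎ (TailsReachable x × Least (Defective x) e)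

  Disconnected : State m → Set
  Disconnected x = ¬ x ⊢ s ⇝ t

  connected? : ∀ x → Dec (x ⊢ s ⇝ t)
  connected? x = path? acyclic x s t

  disconnected? : ∀ x → Dec (Disconnected x)
  disconnected? x = ¬? (connected? x)

  tails-reachable? : ∀ x → Dec (TailsReachable x)
  tails-reachable? x = all? (λ e → reach? acyclic x s (tl e))

  defective? : ∀ x e → Dec (Defective x e)
  defective? x e = kept? e ×-dec any? (λ b → ¬? (b ≟ e) ×-dec hd b ≟ hd e ×-dec x b ≟ᵇ true)

  pivot? : ∀ x e → Dec (Pivot x e)
  pivot? x e = least? (λ e → ¬? (reach? acyclic x s (tl e))) e ⊎-dec tails-reachable? x ×-dec least? (defective? x) e

  pivot-unique : ∀ {x a b} → Pivot x a → Pivot x b → a ≡ b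
  pivot-unique (inj₁ least-a)          (inj₁ least-b)          = least-unique least-a least-b
  pivot-unique (inj₁ (unreach , _))    (inj₂ (reach , _))      = ⊥-elim (unreach (reach _))
  pivot-unique (inj₂ (reach , _))      (inj₁ (unreach , _))    = ⊥-elim (unreach (reach _))
  pivot-unique (inj₂ (_ , least-a))    (inj₂ (_ , least-b))    = least-unique least-a least-b

  unreachable-tail-stable : ∀ {e x x'} → AgreeOff e x x' → UnreachableTail x e → UnreachableTail x' e
  unreachable-tail-stable agree unreach (inj₁ s≡tl) = unreach (inj₁ s≡tl)
  unreachable-tail-stable agree unreach (inj₂ p') with split-at-first-use (agree-sym agree) p'
  ... | inj₁ p = unreach (inj₂ p)
  ... | inj₂ r = unreach r

  path-transfer : ∀ {e x x' w} → AgreeOff e x x' → UnreachableTail x e → x ⊢ s ⇝ w → x' ⊢ s ⇝ w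
  path-transfer agree unreach p with split-at-first-use agree p
  ... | inj₁ p' = p'
  ... | inj₂ r  = ⊥-elim (unreachable-tail-stable agree unreach r)

  toggle-unreachable-pivot : ∀ {e x x'} → AgreeOff e x x' → Disconnected x → Least (UnreachableTail x) e →
    Disconnected x' × Least (UnreachableTail x') e
  toggle-unreachable-pivot agree disc (unreach , e-min) =
      disc ∘ path-transfer (agree-sym agree) unreach'
    , unreach'
    , λ e' e'<e unreach'' → e-min e' e'<e (unreach'' ∘ Sum.map₂ (path-transfer agree unreach))
    where unreach' = unreachable-tail-stable agree unreach

  -- The rival in-arc keeps hd e reachable whether or not e is present.
  toggle-defective-pivot : ∀ {e x x'} → AgreeOff e x x' → Disconnected x → TailsReachable x →
    Least (Defective x) e → Disconnected x' × TailsReachable x' × Least (Defective x') e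
  toggle-defective-pivot {e} {x} {x'} agree disc reach (((canon , hd≢t) , b , b≢e , hdb , xb) , e-min) =
    disc' , reach' , ((canon , hd≢t) , b , b≢e , hdb , x'b) , min'
    where
    x'b : x' b ≡ true
    x'b = trans (sym (agree b b≢e)) xb
    disc' : Disconnected x'
    disc' p' with split-at-last-use (agree-sym agree) p'
    ... | inj₁ p            = disc p
    ... | inj₂ (inj₁ hd≡t) = hd≢t hd≡t
    ... | inj₂ (inj₂ q)    = disc (⇝*-trans (tails-reachable⇒reachable reach (hd e) hd≢t) q)
    present' : InArcsPresent x'
    present' u u≢s u≢t with in-arc (tails-reachable⇒reachable reach u u≢t) u≢s
    ... | c , hdc , xc with c ≟ e
    ...   | yes refl = b , trans hdb hdc , x'b
    ...   | no c≢e   = c , hdc , trans (sym (agree c c≢e)) xc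
    reach' : TailsReachable x'
    reach' e₁ = reachable-from-in-arcs present' (tl e₁) (t-sink e₁)
    min' : ∀ e' → e' < e → ¬ Defective x' e'
    min' e' e'<e (kept' , c , c≢e' , hdc , x'c) with c ≟ e
    ... | yes refl = <-irrefl (sym (canonical-unique canon (proj₁ kept') hdc)) e'<e
    ... | no c≢e   = e-min e' e'<e (kept' , c , c≢e' , hdc , trans (agree c c≢e) x'c)

  Pivoted : State m → Fin m → Set
  Pivoted x e = Disconnected x × Pivot x e

  pivoted-toggle : ∀ {e x x'} → AgreeOff e x x' → Pivoted x e → Pivoted x' e
  pivoted-toggle agree (disc , inj₁ least) = Product.map₂ inj₁ (toggle-unreachable-pivot agree disc least)
  pivoted-toggle agree (disc , inj₂ (reach , least)) with toggle-defective-pivot agree disc reach least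
  ... | disc' , reach' , least' = disc' , inj₂ (reach' , least')

  canonical-state : State m
  canonical-state e = does (kept? e)

  unpivoted⇒canonical : ∀ {x} → Disconnected x → (∀ e → ¬ Pivot x e) → x ≗ canonical-state
  unpivoted⇒canonical {x} disc no-pivot i = ⇔→≡ (mk⇔ (dec-true (kept? i) ∘ to) (from ∘ does-true (kept? i)))
    where
    reach : TailsReachable x
    reach with tails-reachable? x
    ... | yes r  = r
    ... | no ¬r with least-of-¬∀ (λ e → reach? acyclic x s (tl e)) ¬r
    ...   | e , least = ⊥-elim (no-pivot e (inj₁ least))
    no-defect : ∀ e → ¬ Defective x e
    no-defect e defect with least-exists (defective? x) e defect
    ... | a , least = no-pivot a (inj₂ (reach , least))
    to : x i ≡ true → Kept i
    to xi = canon , hd≢t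
      where
      hd≢t : hd i ≢ t
      hd≢t hd≡t = disc (subst (x ⊢ s ⇝_) hd≡t (⇝*-snoc (reach i) refl xi))
      canon : Canonical i
      canon with canonical-arc i
      ... | a , hdₐ , canon-a with i ≟ a
      ...   | yes refl = canon-a
      ...   | no i≢a   =
        ⊥-elim (no-defect a ((canon-a , λ hd≡t → hd≢t (trans (sym hdₐ) hd≡t)) , i , i≢a , sym hdₐ , xi))
    from : Kept i → x i ≡ true
    from kept@(_ , hd≢t) with in-arc (tails-reachable⇒reachable reach (hd i) hd≢t) (s-source i)
    ... | c , hdc , xc with c ≟ i
    ...   | yes refl = xc
    ...   | no c≢i   = ⊥-elim (no-defect i (kept , c , c≢i , hdc , xc))

  canonical⇒unpivoted : ∀ {x} → x ≗ canonical-state → Disconnected x × (∀ e → ¬ Pivot x e)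
  canonical⇒unpivoted {x} x≗κ = disc , no-pivot
    where
    to : ∀ e → x e ≡ true → Kept e
    to e = does-true (kept? e) ∘ trans (sym (x≗κ e))
    from : ∀ e → Kept e → x e ≡ true
    from e = trans (x≗κ e) ∘ dec-true (kept? e)
    disc : Disconnected x
    disc p with last-arc p
    ... | b , hdb , xb = proj₂ (to b xb) hdb
    present : InArcsPresent x
    present u u≢s u≢t with into-arc u u≢s
    ... | e₁ , refl with canonical-arc e₁
    ...   | a , hdₐ , canon-a = a , hdₐ , from a (canon-a , λ hd≡t → u≢t (trans (sym hdₐ) hd≡t))
    reach : TailsReachable x
    reach e = reachable-from-in-arcs present (tl e) (t-sink e)
    no-pivot : ∀ e → ¬ Pivot x e
    no-pivot e (inj₁ (unreach , _)) = unreach (reach e)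
    no-pivot e (inj₂ (_ , ((canon , _) , c , c≢e , hdc , xc) , _)) =
      c≢e (canonical-unique (proj₁ (to c xc)) canon hdc)

  pivoted? : ∀ x e → Dec (Pivoted x e)
  pivoted? x e = disconnected? x ×-dec pivot? x e

  unpivoted? : ∀ x → Dec (Disconnected x × ¬ Σ (Fin m) (Pivoted x))
  unpivoted? x = disconnected? x ×-dec ¬? (any? (pivoted? x))

  disconnected-split : ∀ x →
    indicator (disconnected? x) ≡ indicator (unpivoted? x) + sum (λ e → indicator (pivoted? x e))
  disconnected-split x = trans (indicator-split (disconnected? x) (any? (pivoted? x)) (proj₁ ∘ proj₂))
    (cong (indicator (unpivoted? x) +_)
          (sym (sum-indicator-exclusive (pivoted? x) λ p q → pivot-unique (proj₂ p) (proj₂ q))))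

  Δ-pivoted : ∀ e → Δ m (λ x → indicator (pivoted? x e)) ≡ 0ℚ
  Δ-pivoted e = Δ-independent m e (λ x → indicator (pivoted? x e)) λ {x} {x'} agree →
    indicator-⇔ (mk⇔ (pivoted-toggle agree) (pivoted-toggle (agree-sym agree))) (pivoted? x e) (pivoted? x' e)

  Δ-unpivoted : Δ m (indicator ∘ unpivoted?) ≡ 1ℚ ⊎ Δ m (indicator ∘ unpivoted?) ≡ - 1ℚ
  Δ-unpivoted = Δ-point m canonical-state 1ℚ _ at off
    where
    at : ∀ x → x ≗ canonical-state → indicator (unpivoted? x) ≡ 1ℚ
    at x x≗κ with canonical⇒unpivoted x≗κ
    ... | disc , no-pivot = indicator-yes (unpivoted? x) (disc , λ (e , _ , pivot) → no-pivot e pivot)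
    off : ∀ x → ¬ x ≗ canonical-state → indicator (unpivoted? x) ≡ 0ℚ
    off x x≉κ = indicator-no (unpivoted? x) λ (disc , ∄) →
      x≉κ (unpivoted⇒canonical disc λ e pivot → ∄ (e , disc , pivot))

  Δ-disconnected≡Δ-unpivoted : Δ m (indicator ∘ disconnected?) ≡ Δ m (indicator ∘ unpivoted?)
  Δ-disconnected≡Δ-unpivoted = begin
    Δ m (indicator ∘ disconnected?)
      ≡⟨ Δ-cong m disconnected-split ⟩
    Δ m (λ x → indicator (unpivoted? x) + sum (λ e → indicator (pivoted? x e)))
      ≡⟨ Δ-+ m _ _ ⟩
    Δ m (indicator ∘ unpivoted?) + Δ m (λ x → sum (λ e → indicator (pivoted? x e)))
      ≡⟨ cong (Δ m (indicator ∘ unpivoted?) +_) (Δ-sum m λ e x → indicator (pivoted? x e)) ⟩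
    Δ m (indicator ∘ unpivoted?) + sum (λ e → Δ m (λ x → indicator (pivoted? x e)))
      ≡⟨ cong (Δ m (indicator ∘ unpivoted?) +_) (trans (sum-cong-≗ Δ-pivoted) (sum-replicate-zero m)) ⟩
    Δ m (indicator ∘ unpivoted?) + 0ℚ
      ≡⟨ +-identityʳ _ ⟩
    Δ m (indicator ∘ unpivoted?) ∎
    where open ≡-Reasoning

  Δ-disconnected : Δ m (indicator ∘ disconnected?) ≡ 1ℚ ⊎ Δ m (indicator ∘ disconnected?) ≡ - 1ℚ
  Δ-disconnected = subst (λ q → q ≡ 1ℚ ⊎ q ≡ - 1ℚ) (sym Δ-disconnected≡Δ-unpivoted) Δ-unpivoted

  Δ-connected≢0 : Fin m → Δ m (indicator ∘ connected?) ≢ 0ℚ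
  Δ-connected≢0 e Δf≡0 = [ (λ Δg≡1 → 1≢0 (trans (sym Δg≡1) Δg≡0))
                          , (λ Δg≡-1 → 1≢0 (neg-injective (trans (sym Δg≡-1) Δg≡0))) ] Δ-disconnected
    where
    Δf+Δg≡0 : Δ m (indicator ∘ connected?) + Δ m (indicator ∘ disconnected?) ≡ 0ℚ
    Δf+Δg≡0 = trans (sym (Δ-+ m (indicator ∘ connected?) (indicator ∘ disconnected?)))
                    (trans (Δ-cong m (indicator-complement ∘ connected?)) (Δ-independent m e (λ _ → 1ℚ) λ _ → refl))
    Δg≡0 : Δ m (indicator ∘ disconnected?) ≡ 0ℚ
    Δg≡0 = trans (sym (+-identityˡ _)) (trans (cong (_+ Δ m (indicator ∘ disconnected?)) (sym Δf≡0)) Δf+Δg≡0)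

  connected-extensional : Extensional (indicator ∘ connected?)
  connected-extensional {x} {x'} x≗x' = indicator-⇔
    (mk⇔ (⇝-mono λ i → trans (sym (x≗x' i))) (⇝-mono λ i → trans (x≗x' i))) (connected? x) (connected? x')

mainTheorem5 : {n m : ℕ} (tl hd : Fin m → Fin n) (s t : Fin n) →
    Acyclic tl hd →
    IsSource hd s → (∀ v → IsSource hd v → v ≡ s) →
    IsSink tl t → (∀ v → IsSink tl v → v ≡ t) →
    Σ (MLPoly m) (Represents tl hd s t) ×
    (∀ (p : MLPoly m) → Represents tl hd s t p → degree p ≡ m)
mainTheorem5 {n} {m} tl hd s t acyclic s-source s-unique t-sink t-unique =
  (interpolate m f , represents) , λ p p-represents → degree-full p λ e p⊤≡0 →
    Δ-connected≢0 e (trans (sym (⊤-coefficient m p (eval≗f {p} p-represents))) p⊤≡0)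
  where
  open Involution tl hd s t acyclic s-source s-unique t-sink t-unique
  f : State m → ℚ
  f = indicator ∘ connected?
  represents : Represents tl hd s t (interpolate m f)
  represents x = (λ p → trans (eval-interpolate m f connected-extensional x) (indicator-yes (connected? x) p))
               , (λ ¬p → trans (eval-interpolate m f connected-extensional x) (indicator-no (connected? x) ¬p))
  eval≗f : ∀ {p} → Represents tl hd s t p → eval p ≗ f
  eval≗f p-represents x with connected? x
  ... | yes p = trans (proj₁ (p-represents x) p) (sym (indicator-yes (connected? x) p))
  ... | no ¬p = trans (proj₂ (p-represents x) ¬p) (sym (indicator-no (connected? x) ¬p))
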